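{- Let $\mathcal U$ be an ultrafilter on $\mathbb N$ that is not a Q-point. Then there exists an ultrafilter $\mathcal U'$ isomorphic to $\mathcal U$ that is not quasi-selective.
   Context: $\mathbb N=\{0,1,2,\dots\}$. A nonprincipal ultrafilter $\mathcal U$ on $\mathbb N$ is a Q-point if for every partition of $\mathbb N$ into finite sets there is a set in $\mathcal U$ meeting each piece in at most one point. Two ultrafilters $\mathcal U,\mathcal V$ on $\mathbb N$ are isomorphic if $\mathcal V=f(\mathcal U)=\{B: f^{ -1}(B)\in\mathcal U\}$ for some one-to-one $f:\mathbb N\to\mathbb N$ (equivalently, some bijection). A nonprincipal ultrafilter is quasi-selective if every $f:\mathbb N\to\mathbb N$ with $f(n)\le n$ for all $n$ agrees on a set in the ultrafilter with a nondecreasing function. -}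

module Defs where

open import Data.Nat using (ℕ; _≤_; _<_)
open import Data.Product using (Σ; _×_; ∃; _,_)
open import Data.Sum using (_⊎_)
open import Data.Empty using (⊥)
open import Relation.Nullary using (¬_)
open import Relation.Binary.PropositionalEquality using (_≡_)
open import Function.Definitions using (Injective)

Subset : Set₁
Subset = ℕ → Set

_⊆_ : Subset → Subset → Set
A ⊆ B = ∀ n → A n → B n

_∩_ : Subset → Subset → Subset
(A ∩ B) n = A n × B n

∁ : Subset → Subset
∁ A n = ¬ A n

∅ : Subset
∅ _ = ⊥

｛_｝ : ℕ → Subset
｛ k ｝ n = n ≡ k

record Ultrafilter : Set₁ where
  field
    _∈U      : Subset → Set
    upward   : ∀ {A B} → A ⊆ B → A ∈U → B ∈U
    meet     : ∀ {A B} → A ∈U → B ∈U → (A ∩ B) ∈U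
    proper   : ¬ (∅ ∈U)
    ultra    : ∀ A → A ∈U ⊎ (∁ A) ∈U
open Ultrafilter public

Nonprincipal : Ultrafilter → Set
Nonprincipal 𝒰 = ∀ k → ¬ (_∈U 𝒰 ｛ k ｝)

-- A partition of ℕ into finite sets, given by the piece-index map p
-- (piece k = p⁻¹{k}); each piece is finite (bounded).
FinitePieces : (ℕ → ℕ) → Set
FinitePieces p = ∀ k → ∃ λ b → ∀ n → p n ≡ k → n < b

Selector : (ℕ → ℕ) → Subset → Set
Selector p A = ∀ m n → A m → A n → p m ≡ p n → m ≡ n

IsQPoint : Ultrafilter → Set₁
IsQPoint 𝒰 = Nonprincipal 𝒰 ×
  (∀ p → FinitePieces p → Σ Subset λ A → _∈U 𝒰 A × Selector p A)

-- Classical negation of IsQPoint, stated positively (needed for a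
-- constructive reading).
NotQPoint : Ultrafilter → Set₁
NotQPoint 𝒰 = ¬ Nonprincipal 𝒰 ⊎
  (Σ (ℕ → ℕ) λ p → FinitePieces p × (∀ A → _∈U 𝒰 A → ¬ Selector p A))

Isomorphic : Ultrafilter → Ultrafilter → Set₁
Isomorphic 𝒰 𝒱 = Σ (ℕ → ℕ) λ f → Injective _≡_ _≡_ f ×
  (∀ B → (_∈U 𝒱 B → _∈U 𝒰 (λ n → B (f n))) × (_∈U 𝒰 (λ n → B (f n)) → _∈U 𝒱 B))

Nondecreasing : (ℕ → ℕ) → Set
Nondecreasing g = ∀ m n → m ≤ n → g m ≤ g n

IsQuasiSelective : Ultrafilter → Set₁
IsQuasiSelective 𝒰 = Nonprincipal 𝒰 ×
  (∀ (f : ℕ → ℕ) → (∀ n → f n ≤ n) →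
     Σ (ℕ → ℕ) λ g → Nondecreasing g ×
       Σ Subset λ A → _∈U 𝒰 A × (∀ n → A n → f n ≡ g n))

-- Pull a non-Q-point 𝒰 forward along the injection sending each n in the k-th
-- piece of a witnessing finite partition to 2ᵇ + n, where b bounds that piece.
-- Pieces thus land, in increasing order, inside dyadic blocks
-- [2ᵇ, 2ᵇ⁺¹). Reflecting each dyadic block gives a map below the identity that is
-- strictly decreasing on the image of every piece, so a nondecreasing function
-- agrees with it on at most one point of each image: quasi-selectivity of the
-- image ultrafilter would produce a selector for the partition in 𝒰.
module Submission where

open import Defs
open import Data.Product using (Σ; _×_; _,_; proj₁; proj₂)
open import Relation.Nullary using (¬_)
open import Data.Nat
open import Data.Nat.Properties
open import Data.Nat.Logarithm
open import Data.Sum using (inj₁; inj₂)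
open import Data.Empty using (⊥; ⊥-elim)
open import Function.Definitions using (Injective)
open import Relation.Binary.PropositionalEquality
open import Relation.Binary.Definitions using (tri<; tri≈; tri>)

pushforward : (ℕ → ℕ) → Ultrafilter → Ultrafilter
pushforward f 𝒰 = record
  { _∈U    = λ B → _∈U 𝒰 (λ n → B (f n))
  ; upward = λ A⊆B → upward 𝒰 (λ n → A⊆B (f n))
  ; meet   = meet 𝒰
  ; proper = proper 𝒰
  ; ultra  = λ A → ultra 𝒰 (λ n → A (f n))
  }

pushforward-isomorphic : ∀ {f} 𝒰 → Injective _≡_ _≡_ f → Isomorphic 𝒰 (pushforward f 𝒰)
pushforward-isomorphic {f} _ f-injective = f , f-injective , λ _ → (λ B∈ → B∈) , (λ B∈ → B∈)

Selector-from-< : ∀ {p A} → (∀ {m n} → A m → A n → p m ≡ p n → m < n → ⊥) → Selector p A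
Selector-from-< {p} {A} unordered m n m∈A n∈A same with <-cmp m n
... | tri< m<n _ _ = ⊥-elim (unordered m∈A n∈A same m<n)
... | tri≈ _ m≡n _ = m≡n
... | tri> _ _ n<m = ⊥-elim (unordered n∈A m∈A (sym same) n<m)

n<2^n : ∀ n → n < 2 ^ n
n<2^n zero    = z<s
n<2^n (suc n) = +-mono-≤ (m^n>0 2 n) (≤-trans (n<2^n n) (m≤m+n (2 ^ n) 0))

⌊n/2⌋<m : ∀ n m → n < 2 * m → ⌊ n /2⌋ < m
⌊n/2⌋<m zero          (suc m) _   = z<s
⌊n/2⌋<m (suc zero)    (suc m) _   = z<s
⌊n/2⌋<m (suc (suc n)) (suc m) n<2m =
  s<s (⌊n/2⌋<m n m (s≤s⁻¹ (s≤s⁻¹ (subst (3 + n ≤_) (*-suc 2 m) n<2m))))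

⌊log₂n⌋≤m : ∀ m n → n < 2 ^ suc m → ⌊log₂ n ⌋ ≤ m
⌊log₂n⌋≤m zero    zero          _ = z≤n
⌊log₂n⌋≤m zero    (suc zero)    _ = z≤n
⌊log₂n⌋≤m zero    (suc (suc n)) (s≤s (s≤s ()))
⌊log₂n⌋≤m (suc m) n n<2^[2+m] = begin
  ⌊log₂ n ⌋             ≤⟨ m≤n+m∸n ⌊log₂ n ⌋ 1 ⟩
  1 + (⌊log₂ n ⌋ ∸ 1)   ≡⟨ cong suc (⌊log₂⌊n/2⌋⌋≡⌊log₂n⌋∸1 n) ⟨
  1 + ⌊log₂ ⌊ n /2⌋ ⌋   ≤⟨ s≤s (⌊log₂n⌋≤m m ⌊ n /2⌋ (⌊n/2⌋<m n (2 ^ suc m) n<2^[2+m])) ⟩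
  suc m                 ∎
  where open ≤-Reasoning

⌊log₂[2^m+r]⌋≡m : ∀ m {r} → r < 2 ^ m → ⌊log₂ (2 ^ m + r) ⌋ ≡ m
⌊log₂[2^m+r]⌋≡m m {r} r<2^m = ≤-antisym upper lower
  where
  upper : ⌊log₂ (2 ^ m + r) ⌋ ≤ m
  upper = ⌊log₂n⌋≤m m _ (+-monoʳ-< (2 ^ m) (≤-trans r<2^m (m≤m+n (2 ^ m) 0)))
  lower : m ≤ ⌊log₂ (2 ^ m + r) ⌋
  lower = subst (_≤ ⌊log₂ (2 ^ m + r) ⌋) (⌊log₂[2^n]⌋≡n m) (⌊log₂⌋-mono-≤ (m≤m+n (2 ^ m) r))

-- On each block [2ᵐ, 2ᵐ⁺¹) this is 2ᵐ + r ↦ 2ᵐ ∸ r; the outer ⊓ only matters at 0.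
reflect : ℕ → ℕ
reflect x = x ⊓ (2 ^ ⌊log₂ x ⌋ ∸ (x ∸ 2 ^ ⌊log₂ x ⌋))

reflect≤id : ∀ x → reflect x ≤ x
reflect≤id x = m⊓n≤m x _

reflect[2^m+r] : ∀ m {r} → r < 2 ^ m → reflect (2 ^ m + r) ≡ 2 ^ m ∸ r
reflect[2^m+r] m {r} r<2^m rewrite ⌊log₂[2^m+r]⌋≡m m r<2^m | m+n∸m≡n (2 ^ m) r =
  m≥n⇒m⊓n≡n (≤-trans (m∸n≤m (2 ^ m) r) (m≤m+n (2 ^ m) r))

module BlockEmbedding (p level : ℕ → ℕ) (fits : ∀ n → n < 2 ^ level (p n)) where

  embed : ℕ → ℕ
  embed n = 2 ^ level (p n) + n

  embed-injective : Injective _≡_ _≡_ embed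
  embed-injective {m} {n} eq = +-cancelˡ-≡ (2 ^ level (p m)) m n (begin
    2 ^ level (p m) + m   ≡⟨ eq ⟩
    2 ^ level (p n) + n   ≡⟨ cong (λ k → 2 ^ k + n) same-level ⟨
    2 ^ level (p m) + n   ∎)
    where
    open ≡-Reasoning
    same-level : level (p m) ≡ level (p n)
    same-level = begin
      level (p m)       ≡⟨ ⌊log₂[2^m+r]⌋≡m (level (p m)) (fits m) ⟨
      ⌊log₂ embed m ⌋   ≡⟨ cong ⌊log₂_⌋ eq ⟩
      ⌊log₂ embed n ⌋   ≡⟨ ⌊log₂[2^m+r]⌋≡m (level (p n)) (fits n) ⟩
      level (p n)       ∎

  reflect∘embed-strictAntitone : ∀ {m n} → p m ≡ p n → m < n →
    embed m ≤ embed n × reflect (embed n) < reflect (embed m)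
  reflect∘embed-strictAntitone {m} {n} same m<n rewrite same =
    +-monoʳ-≤ (2 ^ level (p n)) (<⇒≤ m<n) ,
    subst₂ _<_ (sym (reflect[2^m+r] (level (p n)) (fits n)))
               (sym (reflect[2^m+r] (level (p n)) m<2^level))
               (∸-monoʳ-< m<n (<⇒≤ (fits n)))
    where
    m<2^level : m < 2 ^ level (p n)
    m<2^level = subst (λ k → m < 2 ^ level k) same (fits m)

  agreement⇒Selector : ∀ {g A} → Nondecreasing g →
    (∀ n → A n → reflect (embed n) ≡ g (embed n)) → Selector p A
  agreement⇒Selector mono agree = Selector-from-< λ {m} {n} m∈A n∈A same m<n →
    let (embed-≤ , reflect-<) = reflect∘embed-strictAntitone same m<n
    in <-irrefl refl (<-≤-trans reflect-<
         (subst₂ _≤_ (sym (agree m m∈A)) (sym (agree n n∈A))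
                 (mono (embed m) (embed n) embed-≤)))

proposition1p9 : (𝒰 : Ultrafilter) → NotQPoint 𝒰 →
    Σ Ultrafilter (λ 𝒰′ → Isomorphic 𝒰 𝒰′ × ¬ IsQuasiSelective 𝒰′)
proposition1p9 𝒰 (inj₁ principal) =
  pushforward (λ n → n) 𝒰 , pushforward-isomorphic 𝒰 (λ eq → eq) , λ qs → principal (proj₁ qs)
proposition1p9 𝒰 (inj₂ (p , finite , noSelector)) =
  pushforward embed 𝒰 , pushforward-isomorphic 𝒰 embed-injective , notQuasiSelective
  where
  bound : ℕ → ℕ
  bound k = proj₁ (finite k)

  fits : ∀ n → n < 2 ^ bound (p n)
  fits n = <-trans (proj₂ (finite (p n)) n refl) (n<2^n (bound (p n)))

  open BlockEmbedding p bound fits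

  notQuasiSelective : ¬ IsQuasiSelective (pushforward embed 𝒰)
  notQuasiSelective (_ , quasiSelective) with quasiSelective reflect reflect≤id
  ... | _ , mono , A , A∈ , agree =
    noSelector _ A∈ (agreement⇒Selector mono (λ n → agree (embed n)))
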